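{- Let $C \ge h$ and let $B$ be a uniformly random bay with $C+1$ columns and $h$ containers per column. Call a column special if all of its containers have labels at least $\omega = (h-1)(C+1)+1$, and let $\Omega$ be the event that $B$ has at least one special column. Then $\mathbb{P}(\overline{\Omega}) \le e^{ -\theta(C+1)}$, where $\theta = \frac{1}{8h}\left(\frac{2}{h(h+1)}\right)^{2h} > 0$.
   Context: A uniformly random bay with $C+1$ columns and $h$ containers per column contains $h(C+1)$ containers labelled $1,\dots,h(C+1)$; it is generated by drawing a uniformly random permutation $\pi$ of $\{1,\dots,h(C+1)\}$ and placing container $\pi(h(i-1)+j)$ in column $i$ at tier $j$ (from the bottom) for $1\le j\le h$. -}

module Defs where

open import Data.Nat using (ℕ; zero; suc; _+_; _*_; _≤ᵇ_; _!)
open import Data.List using (List; []; _∷_; map; concatMap; take; drop; upTo; length; filterᵇ)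
open import Data.Bool.ListAction using (all; any)
open import Data.Bool using (Bool; not)
open import Data.Integer using (+_)
open import Data.Rational using (ℚ; _/_; 0ℚ; 1ℚ) renaming (_+_ to _+ℚ_; _*_ to _*ℚ_)

insertions : ℕ → List ℕ → List (List ℕ)
insertions x [] = (x ∷ []) ∷ []
insertions x (y ∷ ys) = (x ∷ y ∷ ys) ∷ map (y ∷_) (insertions x ys)

-- All permutations (orderings) of a list; for a list of distinct elements
-- each ordering appears exactly once.
perms : List ℕ → List (List ℕ)
perms [] = [] ∷ []
perms (x ∷ xs) = concatMap (insertions x) (perms xs)

labels : ℕ → List ℕ
labels n = map suc (upTo n)

-- The bay given by pi = (pi(1), ..., pi(h(C+1))): column i (i = 1..C+1)
-- consists of pi(h(i-1)+1), ..., pi(h(i-1)+h) (bottom to top).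
columns : (h c : ℕ) → List ℕ → List (List ℕ)
columns h zero l = []
columns h (suc c) l = take h l ∷ columns h c (drop h l)

-- omega = (h-1)(C+1)+1 ; written so that (h-1)(C+1) + 1 makes sense for h ≥ 1
omega : (h C : ℕ) → ℕ
omega zero C = 1
omega (suc k) C = k * suc C + 1

special : (h C : ℕ) → List ℕ → Bool
special h C col = all (λ x → omega h C ≤ᵇ x) col

noSpecial : (h C : ℕ) → List ℕ → Bool
noSpecial h C l = not (any (special h C) (columns h (suc C) l))

allBays : (h C : ℕ) → List (List ℕ)
allBays h C = perms (labels (h * suc C))

-- rational n/d, with the (unused) convention n/0 = 0
frac : ℕ → ℕ → ℚ
frac n zero = 0ℚ
frac n (suc d) = + n / suc d

probNotOmega : (h C : ℕ) → ℚ
probNotOmega h C = frac (length (filterᵇ (noSpecial h C) (allBays h C))) ((h * suc C) !)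

_^ℚ_ : ℚ → ℕ → ℚ
q ^ℚ zero = 1ℚ
q ^ℚ suc k = q *ℚ (q ^ℚ k)

theta : ℕ → ℚ
theta h = frac 1 (8 * h) *ℚ (frac 2 (h * (h + 1)) ^ℚ (2 * h))

expPartial : ℚ → ℕ → ℚ
expPartial t zero = 1ℚ
expPartial t (suc N) = expPartial t N +ℚ ((t ^ℚ suc N) *ℚ frac 1 (suc N !))

-- Reveal the columns one at a time.  While k columns remain and at least D of their labels
-- are large (at least ω) with 2k ≤ (h + 1)D, the next column consists of large labels only
-- with probability at least ρ = (2 / (h(h + 1)))^h, and a column that is not special uses
-- at most h − 1 large labels.  As there are C + 1 large labels, this applies to the first
-- t = ⌊(C + 1) / (h + 1)⌋ columns, so P(Ω̄) ≤ (1 − ρ)^t.  Since θ = ρ² / (8h), Bernoulli's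
-- inequality gives 1 − ρ ≤ (1 − θ)^(2(h + 1)), and 2(h + 1)t ≥ C + 1, hence
-- P(Ω̄) ≤ (1 − θ)^(C + 1).  Finally (1 − θ) E(x + θ) ≤ E(x) for every partial sum E of the
-- exponential series, so (1 − θ)^(C + 1) E(θ(C + 1)) ≤ E(0) = 1.
module Submission where

open import Defs

module Counting where

  open import Data.Nat
  open import Data.Nat.Properties
  open import Data.Nat.Tactic.RingSolver using (solve-∀)
  open import Data.Bool using (Bool; true; false; not; _∧_; _∨_; T)
  open import Data.Bool.ListAction using (all; any)
  open import Data.List using (List; []; _∷_; _++_; map; concatMap; take; drop; length; filterᵇ; applyUpTo; upTo)
  open import Data.List.Properties using (length-++; length-map; length-upTo; map-upTo)
  open import Data.List.Relation.Unary.All as All using (All; []; _∷_)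
  import Data.List.Relation.Unary.All.Properties as All
  open import Data.List.Relation.Binary.Permutation.Propositional using (_↭_; refl; prep; swap; trans; ↭-sym)
  open import Data.List.Relation.Binary.Permutation.Propositional.Properties using (↭-length)
  open import Data.Product using (_×_; _,_; proj₁; map₁; map₂)
  open import Function using (_∘_)
  open import Relation.Binary.PropositionalEquality
    using (_≡_; refl; sym; cong; cong₂; subst; module ≡-Reasoning)
    renaming (trans to ≡-trans)

  ∑ : {A : Set} → List A → (A → ℕ) → ℕ
  ∑ [] f = 0
  ∑ (x ∷ xs) f = f x + ∑ xs f

  ∑-++ : ∀ {A : Set} xs ys (f : A → ℕ) → ∑ (xs ++ ys) f ≡ ∑ xs f + ∑ ys f
  ∑-++ [] ys f = refl
  ∑-++ (x ∷ xs) ys f = ≡-trans (cong (f x +_) (∑-++ xs ys f)) (sym (+-assoc (f x) _ _))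

  ∑-map : ∀ {A B : Set} (g : A → B) xs (f : B → ℕ) → ∑ (map g xs) f ≡ ∑ xs (f ∘ g)
  ∑-map g [] f = refl
  ∑-map g (x ∷ xs) f = cong (f (g x) +_) (∑-map g xs f)

  ∑-concatMap : ∀ {A B : Set} (g : A → List B) xs (f : B → ℕ) → ∑ (concatMap g xs) f ≡ ∑ xs (λ x → ∑ (g x) f)
  ∑-concatMap g [] f = refl
  ∑-concatMap g (x ∷ xs) f =
    ≡-trans (∑-++ (g x) (concatMap g xs) f) (cong (∑ (g x) f +_) (∑-concatMap g xs f))

  ∑-cong : ∀ {A : Set} {xs} {f g : A → ℕ} → All (λ x → f x ≡ g x) xs → ∑ xs f ≡ ∑ xs g
  ∑-cong [] = refl
  ∑-cong (e ∷ es) = cong₂ _+_ e (∑-cong es)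

  ∑-mono-≤ : ∀ {A : Set} {xs} {f g : A → ℕ} → All (λ x → f x ≤ g x) xs → ∑ xs f ≤ ∑ xs g
  ∑-mono-≤ [] = z≤n
  ∑-mono-≤ (le ∷ les) = +-mono-≤ le (∑-mono-≤ les)

  ∑-+ : ∀ {A : Set} xs (f g : A → ℕ) → ∑ xs (λ x → f x + g x) ≡ ∑ xs f + ∑ xs g
  ∑-+ [] f g = refl
  ∑-+ (x ∷ xs) f g = ≡-trans (cong (f x + g x +_) (∑-+ xs f g)) (+-interchange (f x) (g x) _ _)
    where
    +-interchange : ∀ a b c d → a + b + (c + d) ≡ a + c + (b + d)
    +-interchange = solve-∀

  ∑-*ˡ : ∀ {A : Set} c xs (f : A → ℕ) → ∑ xs (λ x → c * f x) ≡ c * ∑ xs f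
  ∑-*ˡ c [] f = sym (*-zeroʳ c)
  ∑-*ˡ c (x ∷ xs) f = ≡-trans (cong (c * f x +_) (∑-*ˡ c xs f)) (sym (*-distribˡ-+ c (f x) _))

  ∑-*ʳ : ∀ {A : Set} c xs (f : A → ℕ) → ∑ xs (λ x → f x * c) ≡ ∑ xs f * c
  ∑-*ʳ c [] f = refl
  ∑-*ʳ c (x ∷ xs) f = ≡-trans (cong (f x * c +_) (∑-*ʳ c xs f)) (sym (*-distribʳ-+ c (f x) _))

  ∑-const : ∀ {A : Set} (xs : List A) c → ∑ xs (λ _ → c) ≡ length xs * c
  ∑-const [] c = refl
  ∑-const (x ∷ xs) c = cong (c +_) (∑-const xs c)

  ∑-↭ : ∀ {A : Set} {xs ys} (f : A → ℕ) → xs ↭ ys → ∑ xs f ≡ ∑ ys f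
  ∑-↭ f refl = refl
  ∑-↭ f (prep x p) = cong (f x +_) (∑-↭ f p)
  ∑-↭ f (swap x y p) = ≡-trans (cong (λ s → f x + (f y + s)) (∑-↭ f p)) (+-swap (f x) (f y) _)
    where
    +-swap : ∀ a b c → a + (b + c) ≡ b + (a + c)
    +-swap = solve-∀
  ∑-↭ f (trans p q) = ≡-trans (∑-↭ f p) (∑-↭ f q)

  ∑-1 : ∀ {A : Set} (xs : List A) → ∑ xs (λ _ → 1) ≡ length xs
  ∑-1 xs = ≡-trans (∑-const xs 1) (*-identityʳ (length xs))

  𝟙 : Bool → ℕ
  𝟙 true = 1
  𝟙 false = 0

  𝟙-∧ : ∀ b c → 𝟙 (b ∧ c) ≡ 𝟙 b * 𝟙 c
  𝟙-∧ true c = sym (+-identityʳ (𝟙 c))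
  𝟙-∧ false c = refl

  𝟙-not : ∀ b → 𝟙 (not b) + 𝟙 b ≡ 1
  𝟙-not true = refl
  𝟙-not false = refl

  𝟙-not-∨ : ∀ b c → 𝟙 (not (b ∨ c)) ≡ 𝟙 (not b) * 𝟙 (not c)
  𝟙-not-∨ true c = refl
  𝟙-not-∨ false c = sym (+-identityʳ (𝟙 (not c)))

  count : {A : Set} → (A → Bool) → List A → ℕ
  count p xs = ∑ xs (𝟙 ∘ p)

  count≤length : ∀ {A : Set} (p : A → Bool) xs → count p xs ≤ length xs
  count≤length p [] = z≤n
  count≤length p (x ∷ xs) with p x
  ... | true = s≤s (count≤length p xs)
  ... | false = m≤n⇒m≤1+n (count≤length p xs)

  count-all-< : ∀ {A : Set} (p : A → Bool) xs → all p xs ≡ false → count p xs < length xs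
  count-all-< p (x ∷ xs) eq with p x
  ... | true = s≤s (count-all-< p xs eq)
  ... | false = s≤s (count≤length p xs)

  select : {A : Set} → List A → List (A × List A)
  select [] = []
  select (x ∷ xs) = (x , xs) ∷ map (map₂ (x ∷_)) (select xs)

  select-↭ : ∀ {A : Set} (xs : List A) → All (λ (y , r) → y ∷ r ↭ xs) (select xs)
  select-↭ [] = []
  select-↭ (x ∷ xs) = refl ∷ All.map⁺ (All.map (λ {(y , r)} p → trans (swap y x refl) (prep x p)) (select-↭ xs))

  ∑-select-proj₁ : ∀ {A : Set} (xs : List A) f → ∑ (select xs) (f ∘ proj₁) ≡ ∑ xs f
  ∑-select-proj₁ [] f = refl
  ∑-select-proj₁ (x ∷ xs) f = cong (f x +_) (≡-trans (∑-map (map₂ (x ∷_)) (select xs) (f ∘ proj₁)) (∑-select-proj₁ xs f))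

  ∑-perms-select : ∀ x xs (w : List ℕ → ℕ) →
    ∑ (perms (x ∷ xs)) w ≡ ∑ (select (x ∷ xs)) (λ (y , r) → ∑ (perms r) (w ∘ (y ∷_)))
  ∑-perms-select x [] w = cong (_+ 0) (sym (+-identityʳ (w (x ∷ []))))
  ∑-perms-select x (z ∷ zs) w = begin
      ∑ (perms (x ∷ z ∷ zs)) w
    ≡⟨ ∑-concatMap (insertions x) (perms (z ∷ zs)) w ⟩
      ∑ (perms (z ∷ zs)) (λ π → ∑ (insertions x π) w)
    ≡⟨ ∑-perms-select z zs (λ π → ∑ (insertions x π) w) ⟩
      ∑ sel (λ (y , r) → ∑ (perms r) (λ π → w (x ∷ y ∷ π) + ∑ (map (y ∷_) (insertions x π)) w))
    ≡⟨ ∑-cong (All.universal split sel) ⟩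
      ∑ sel (λ p → xFirst p + xLater p)
    ≡⟨ ∑-+ sel xFirst xLater ⟩
      ∑ sel xFirst + ∑ sel xLater
    ≡⟨ cong₂ _+_ (sym (∑-perms-select z zs (w ∘ (x ∷_)))) (sym (∑-map (map₂ (x ∷_)) sel _)) ⟩
      ∑ (perms (z ∷ zs)) (w ∘ (x ∷_)) + ∑ (map (map₂ (x ∷_)) sel) (λ (y , r) → ∑ (perms r) (w ∘ (y ∷_)))
    ∎
    where
    open ≡-Reasoning
    sel = select (z ∷ zs)
    xFirst xLater : ℕ × List ℕ → ℕ
    xFirst (y , r) = ∑ (perms r) (λ π → w (x ∷ y ∷ π))
    xLater (y , r) = ∑ (perms (x ∷ r)) (w ∘ (y ∷_))
    split : ∀ ((y , r) : ℕ × List ℕ) →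
      ∑ (perms r) (λ π → w (x ∷ y ∷ π) + ∑ (map (y ∷_) (insertions x π)) w) ≡ xFirst (y , r) + xLater (y , r)
    split (y , r) = begin
        ∑ (perms r) (λ π → w (x ∷ y ∷ π) + ∑ (map (y ∷_) (insertions x π)) w)
      ≡⟨ ∑-cong (All.universal (λ π → cong (w (x ∷ y ∷ π) +_) (∑-map (y ∷_) (insertions x π) w)) (perms r)) ⟩
        ∑ (perms r) (λ π → w (x ∷ y ∷ π) + ∑ (insertions x π) (w ∘ (y ∷_)))
      ≡⟨ ∑-+ (perms r) _ _ ⟩
        xFirst (y , r) + ∑ (perms r) (λ π → ∑ (insertions x π) (w ∘ (y ∷_)))
      ≡⟨ cong (xFirst (y , r) +_) (sym (∑-concatMap (insertions x) (perms r) (w ∘ (y ∷_)))) ⟩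
        xFirst (y , r) + xLater (y , r)
      ∎

  falling : ℕ → ℕ → ℕ
  falling n zero = 1
  falling zero (suc j) = 0
  falling (suc n) (suc j) = suc n * falling n j

  falling-suc : ∀ n j → n * falling (pred n) j ≡ falling n (suc j)
  falling-suc zero j = refl
  falling-suc (suc n) j = refl

  falling-n-n : ∀ n → falling n n ≡ n !
  falling-n-n zero = refl
  falling-n-n (suc n) = cong (suc n *_) (falling-n-n n)

  arrangements : {A : Set} → ℕ → List A → List (List A × List A)
  arrangements zero xs = ([] , xs) ∷ []
  arrangements (suc j) xs = concatMap (λ (y , r) → map (map₁ (y ∷_)) (arrangements j r)) (select xs)

  arrangements-↭ : ∀ {A : Set} j (xs : List A) → All (λ (s , r) → length s ≡ j × s ++ r ↭ xs) (arrangements j xs)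
  arrangements-↭ zero xs = (refl , refl) ∷ []
  arrangements-↭ {A} (suc j) xs = All.concat⁺ (All.map⁺ (All.map extend (select-↭ xs)))
    where
    extend : ∀ {(y , r) : A × List A} → y ∷ r ↭ xs →
      All (λ (s , r′) → length s ≡ suc j × s ++ r′ ↭ xs) (map (map₁ (y ∷_)) (arrangements j r))
    extend {y , r} y∷r↭xs = All.map⁺ (All.map (λ (len , p) → cong suc len , trans (prep y p) y∷r↭xs) (arrangements-↭ j r))

  ∑-perms-arrangements : ∀ j xs (F : List ℕ → List ℕ → ℕ) → j ≤ length xs →
    ∑ (perms xs) (λ π → F (take j π) (drop j π)) ≡ ∑ (arrangements j xs) (λ (s , r) → ∑ (perms r) (F s))
  ∑-perms-arrangements zero xs F _ = sym (+-identityʳ _)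
  ∑-perms-arrangements (suc j) (x ∷ xs) F (s≤s j≤n) = begin
      ∑ (perms (x ∷ xs)) (λ π → F (take (suc j) π) (drop (suc j) π))
    ≡⟨ ∑-perms-select x xs (λ π → F (take (suc j) π) (drop (suc j) π)) ⟩
      ∑ (select (x ∷ xs)) (λ (y , r) → ∑ (perms r) (λ π → F (y ∷ take j π) (drop j π)))
    ≡⟨ ∑-cong (All.map recurse (select-↭ (x ∷ xs))) ⟩
      ∑ (select (x ∷ xs)) (λ (y , r) → ∑ (map (map₁ (y ∷_)) (arrangements j r)) (λ (s , r′) → ∑ (perms r′) (F s)))
    ≡⟨ sym (∑-concatMap (λ (y , r) → map (map₁ (y ∷_)) (arrangements j r)) (select (x ∷ xs))
                        (λ (s , r) → ∑ (perms r) (F s))) ⟩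
      ∑ (arrangements (suc j) (x ∷ xs)) (λ (s , r) → ∑ (perms r) (F s))
    ∎
    where
    open ≡-Reasoning
    recurse : ∀ {(y , r) : ℕ × List ℕ} → y ∷ r ↭ x ∷ xs →
      ∑ (perms r) (λ π → F (y ∷ take j π) (drop j π))
        ≡ ∑ (map (map₁ (y ∷_)) (arrangements j r)) (λ (s , r′) → ∑ (perms r′) (F s))
    recurse {y , r} p = ≡-trans
      (∑-perms-arrangements j r (F ∘ (y ∷_)) (subst (j ≤_) (suc-injective (↭-length (↭-sym p))) j≤n))
      (sym (∑-map (map₁ (y ∷_)) (arrangements j r) (λ (s , r′) → ∑ (perms r′) (F s))))

  count-all-arrangements : ∀ {A : Set} (p : A → Bool) j xs →
    ∑ (arrangements j xs) (λ (s , _) → 𝟙 (all p s)) ≡ falling (count p xs) j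
  count-all-arrangements p zero xs = refl
  count-all-arrangements {A} p (suc j) xs = begin
      ∑ (arrangements (suc j) xs) (λ (s , _) → 𝟙 (all p s))
    ≡⟨ ∑-concatMap (λ (y , r) → map (map₁ (y ∷_)) (arrangements j r)) (select xs) (λ (s , _) → 𝟙 (all p s)) ⟩
      ∑ (select xs) (λ (y , r) → ∑ (map (map₁ (y ∷_)) (arrangements j r)) (λ (s , _) → 𝟙 (all p s)))
    ≡⟨ ∑-cong (All.map recurse (select-↭ xs)) ⟩
      ∑ (select xs) (λ (y , _) → 𝟙 (p y) * falling (pred (count p xs)) j)
    ≡⟨ ∑-*ʳ _ (select xs) (𝟙 ∘ p ∘ proj₁) ⟩
      ∑ (select xs) (𝟙 ∘ p ∘ proj₁) * falling (pred (count p xs)) j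
    ≡⟨ cong (_* falling (pred (count p xs)) j) (∑-select-proj₁ xs (𝟙 ∘ p)) ⟩
      count p xs * falling (pred (count p xs)) j
    ≡⟨ falling-suc (count p xs) j ⟩
      falling (count p xs) (suc j)
    ∎
    where
    open ≡-Reasoning
    drop-𝟙 : ∀ b c → 𝟙 b * falling c j ≡ 𝟙 b * falling (pred (𝟙 b + c)) j
    drop-𝟙 true c = refl
    drop-𝟙 false c = refl
    recurse : ∀ {(y , r) : A × List A} → y ∷ r ↭ xs →
      ∑ (map (map₁ (y ∷_)) (arrangements j r)) (λ (s , _) → 𝟙 (all p s)) ≡ 𝟙 (p y) * falling (pred (count p xs)) j
    recurse {y , r} y∷r↭xs = begin
        ∑ (map (map₁ (y ∷_)) (arrangements j r)) (λ (s , _) → 𝟙 (all p s))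
      ≡⟨ ∑-map (map₁ (y ∷_)) (arrangements j r) (λ (s , _) → 𝟙 (all p s)) ⟩
        ∑ (arrangements j r) (λ (s , _) → 𝟙 (p y ∧ all p s))
      ≡⟨ ∑-cong (All.universal (λ (s , _) → 𝟙-∧ (p y) (all p s)) (arrangements j r)) ⟩
        ∑ (arrangements j r) (λ (s , _) → 𝟙 (p y) * 𝟙 (all p s))
      ≡⟨ ∑-*ˡ (𝟙 (p y)) (arrangements j r) _ ⟩
        𝟙 (p y) * ∑ (arrangements j r) (λ (s , _) → 𝟙 (all p s))
      ≡⟨ cong (𝟙 (p y) *_) (count-all-arrangements p j r) ⟩
        𝟙 (p y) * falling (count p r) j
      ≡⟨ drop-𝟙 (p y) (count p r) ⟩
        𝟙 (p y) * falling (pred (count p (y ∷ r))) j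
      ≡⟨ cong (λ n → 𝟙 (p y) * falling (pred n) j) (∑-↭ (𝟙 ∘ p) y∷r↭xs) ⟩
        𝟙 (p y) * falling (pred (count p xs)) j
      ∎

  length-arrangements : ∀ {A : Set} j (xs : List A) → length (arrangements j xs) ≡ falling (length xs) j
  length-arrangements {A} j xs = begin
      length (arrangements j xs)
    ≡⟨ sym (∑-1 (arrangements j xs)) ⟩
      ∑ (arrangements j xs) (λ _ → 1)
    ≡⟨ ∑-cong (All.universal (λ ((s , _) : List A × List A) → cong 𝟙 (sym (all-true s))) (arrangements j xs)) ⟩
      ∑ (arrangements j xs) (λ (s , _) → 𝟙 (all (λ _ → true) s))
    ≡⟨ count-all-arrangements (λ _ → true) j xs ⟩
      falling (∑ xs (λ _ → 1)) j
    ≡⟨ cong (λ n → falling n j) (∑-1 xs) ⟩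
      falling (length xs) j
    ∎
    where
    open ≡-Reasoning
    all-true : ∀ {B : Set} (ys : List B) → all (λ _ → true) ys ≡ true
    all-true [] = refl
    all-true (_ ∷ ys) = all-true ys

  length-perms : ∀ xs → length (perms xs) ≡ length xs !
  length-perms xs = begin
      length (perms xs)
    ≡⟨ sym (∑-1 (perms xs)) ⟩
      ∑ (perms xs) (λ _ → 1)
    ≡⟨ ∑-perms-arrangements n xs (λ _ _ → 1) ≤-refl ⟩
      ∑ (arrangements n xs) (λ (_ , r) → ∑ (perms r) (λ _ → 1))
    ≡⟨ ∑-cong (All.map (λ {a} → nothing-left {a}) (arrangements-↭ n xs)) ⟩
      ∑ (arrangements n xs) (λ _ → 1)
    ≡⟨ ∑-1 (arrangements n xs) ⟩
      length (arrangements n xs)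
    ≡⟨ length-arrangements n xs ⟩
      falling n n
    ≡⟨ falling-n-n n ⟩
      n !
    ∎
    where
    open ≡-Reasoning
    n = length xs
    count-perms-[] : ∀ r → length r ≡ 0 → ∑ (perms r) (λ _ → 1) ≡ 1
    count-perms-[] [] _ = refl
    nothing-left : ∀ {(s , r) : List ℕ × List ℕ} → length s ≡ n × s ++ r ↭ xs → ∑ (perms r) (λ _ → 1) ≡ 1
    nothing-left {s , r} (len , p) = count-perms-[] r (+-cancelˡ-≡ (length s) _ 0
      (≡-trans (sym (length-++ s)) (≡-trans (↭-length p) (≡-trans (sym len) (sym (+-identityʳ _))))))

  -- Additive form of a bound by (falling (length xs) (suc i) ∸ falling (count p xs) (suc i)) * B:
  -- exactly falling (count p xs) (suc i) ordered choices of the first suc i entries lie in p,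
  -- and every other choice leaves a remainder that lost at most i elements of p.
  ∑-perms-prefix-bound : ∀ (p : ℕ → Bool) i xs (g : List ℕ → ℕ) B → suc i ≤ length xs →
    (∀ r → length r + suc i ≡ length xs → count p xs ≤ i + count p r → ∑ (perms r) g ≤ B) →
    ∑ (perms xs) (λ π → 𝟙 (not (all p (take (suc i) π))) * g (drop (suc i) π)) + falling (count p xs) (suc i) * B
      ≤ falling (length xs) (suc i) * B
  ∑-perms-prefix-bound p i xs g B i<n bound = begin
      ∑ (perms xs) (λ π → 𝟙 (not (all p (take j π))) * g (drop j π)) + falling (count p xs) j * B
    ≡⟨ cong₂ _+_ (∑-perms-arrangements j xs (λ s π → 𝟙 (not (all p s)) * g π) i<n)
                 (cong (_* B) (sym (count-all-arrangements p j xs))) ⟩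
      ∑ arr (λ (s , r) → ∑ (perms r) (λ π → 𝟙 (not (all p s)) * g π)) + ∑ arr allPrefix * B
    ≡⟨ cong₂ _+_ (∑-cong (All.universal (λ ((s , r) : List ℕ × List ℕ) → ∑-*ˡ (𝟙 (not (all p s))) (perms r) g) arr))
                 (sym (∑-*ʳ B arr allPrefix)) ⟩
      ∑ arr (λ (s , r) → 𝟙 (not (all p s)) * ∑ (perms r) g) + ∑ arr (λ a → allPrefix a * B)
    ≤⟨ +-monoˡ-≤ _ (∑-mono-≤ (All.map (λ {a} → bounded {a}) (arrangements-↭ j xs))) ⟩
      ∑ arr (λ a → notAllPrefix a * B) + ∑ arr (λ a → allPrefix a * B)
    ≡⟨ sym (∑-+ arr (λ a → notAllPrefix a * B) (λ a → allPrefix a * B)) ⟩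
      ∑ arr (λ a → notAllPrefix a * B + allPrefix a * B)
    ≡⟨ ∑-cong (All.universal (λ ((s , _) : List ℕ × List ℕ) → ≡-trans (sym (*-distribʳ-+ B (𝟙 (not (all p s))) (𝟙 (all p s))))
                 (≡-trans (cong (_* B) (𝟙-not (all p s))) (*-identityˡ B))) arr) ⟩
      ∑ arr (λ _ → B)
    ≡⟨ ∑-const arr B ⟩
      length arr * B
    ≡⟨ cong (_* B) (length-arrangements j xs) ⟩
      falling (length xs) j * B
    ∎
    where
    open ≤-Reasoning
    j = suc i
    arr = arrangements j xs
    allPrefix notAllPrefix : List ℕ × List ℕ → ℕ
    allPrefix (s , _) = 𝟙 (all p s)
    notAllPrefix (s , _) = 𝟙 (not (all p s))
    bounded : ∀ {(s , r) : List ℕ × List ℕ} → length s ≡ j × s ++ r ↭ xs →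
      notAllPrefix (s , r) * ∑ (perms r) g ≤ notAllPrefix (s , r) * B
    bounded {s , r} (len , s++r↭xs) with all p s in notAll
    ... | true = z≤n
    ... | false = *-monoʳ-≤ 1 (bound r length-rest count-rest)
      where
      length-rest : length r + j ≡ length xs
      length-rest = ≡-trans (+-comm (length r) j) (≡-trans (cong (_+ length r) (sym len))
        (≡-trans (sym (length-++ s)) (↭-length s++r↭xs)))
      count-rest : count p xs ≤ i + count p r
      count-rest = ≤-trans (≤-reflexive (≡-trans (sym (∑-↭ (𝟙 ∘ p) s++r↭xs)) (∑-++ s r (𝟙 ∘ p))))
        (+-monoˡ-≤ (count p r) (≤-pred (subst (count p s <_) len (count-all-< p s notAll))))

  falling≤^ : ∀ n j → falling n j ≤ n ^ j
  falling≤^ n zero = ≤-refl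
  falling≤^ zero (suc j) = z≤n
  falling≤^ (suc n) (suc j) = *-monoʳ-≤ (suc n) (≤-trans (falling≤^ n j) (^-monoˡ-≤ j (n≤1+n n)))

  ^≤falling : ∀ i n → n ^ suc i ≤ falling (i + n) (suc i)
  ^≤falling zero zero = z≤n
  ^≤falling zero (suc n) = ≤-refl
  ^≤falling (suc i) n = *-mono-≤ (m≤n+m n (suc i)) (^≤falling i n)

  falling-monoˡ-≤ : ∀ {m n} j → m ≤ n → falling m j ≤ falling n j
  falling-monoˡ-≤ zero m≤n = ≤-refl
  falling-monoˡ-≤ {zero} (suc j) m≤n = z≤n
  falling-monoˡ-≤ {suc m} {suc n} (suc j) (s≤s m≤n) = *-mono-≤ (s≤s m≤n) (falling-monoˡ-≤ j m≤n)

  !-split : ∀ j n → (j + n) ! ≡ falling (j + n) j * n !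
  !-split zero n = sym (+-identityʳ (n !))
  !-split (suc j) n = ≡-trans (cong (suc (j + n) *_) (!-split j n)) (sym (*-assoc (suc (j + n)) (falling (j + n) j) (n !)))

  ^-distribʳ-* : ∀ m n j → (m * n) ^ j ≡ m ^ j * n ^ j
  ^-distribʳ-* m n zero = refl
  ^-distribʳ-* m n (suc j) = ≡-trans (cong (m * n *_) (^-distribʳ-* m n j)) (*-interchange m n (m ^ j) (n ^ j))
    where
    *-interchange : ∀ a b c d → a * b * (c * d) ≡ a * c * (b * d)
    *-interchange = solve-∀

  -- The h-prefixes lying inside a set of L labels make up a fraction ≥ (2 / (h (h + 1))) ^ h
  -- of all h-prefixes of h k labels.
  column-bound : ∀ a k D L → let h = suc a in 2 * k ≤ (h + 1) * D → a + D ≤ L →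
    falling (h * k) h * 2 ^ h ≤ falling L h * (h * (h + 1)) ^ h
  column-bound a k D L 2k≤ a+D≤L = begin
      falling (h * k) h * 2 ^ h
    ≤⟨ *-monoˡ-≤ (2 ^ h) (falling≤^ (h * k) h) ⟩
      (h * k) ^ h * 2 ^ h
    ≡⟨ sym (^-distribʳ-* (h * k) 2 h) ⟩
      (h * k * 2) ^ h
    ≤⟨ ^-monoˡ-≤ h (≤-trans (≤-reflexive (reassoc₁ h k)) (≤-trans (*-monoʳ-≤ h 2k≤) (≤-reflexive (reassoc₂ h D)))) ⟩
      (H * D) ^ h
    ≡⟨ ^-distribʳ-* H D h ⟩
      H ^ h * D ^ h
    ≤⟨ *-monoʳ-≤ (H ^ h) (≤-trans (^≤falling a D) (falling-monoˡ-≤ h a+D≤L)) ⟩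
      H ^ h * falling L h
    ≡⟨ *-comm (H ^ h) (falling L h) ⟩
      falling L h * H ^ h
    ∎
    where
    open ≤-Reasoning
    h = suc a
    H = h * (h + 1)
    reassoc₁ : ∀ h k → h * k * 2 ≡ h * (2 * k)
    reassoc₁ = solve-∀
    reassoc₂ : ∀ h D → h * ((h + 1) * D) ≡ h * (h + 1) * D
    reassoc₂ = solve-∀

  complement-bound : ∀ Q R P F {Z T B} → Q ≡ R + P → Z + F * B ≤ T * B → T * P ≤ F * Q → Q * Z ≤ R * T * B
  complement-bound Q R P F {Z} {T} {B} Q≡R+P ZF≤T TP≤FQ = +-cancelʳ-≤ (Q * (F * B)) (Q * Z) (R * T * B) (begin
      Q * Z + Q * (F * B)
    ≡⟨ sym (*-distribˡ-+ Q Z (F * B)) ⟩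
      Q * (Z + F * B)
    ≤⟨ *-monoʳ-≤ Q ZF≤T ⟩
      Q * (T * B)
    ≡⟨ cong (_* (T * B)) Q≡R+P ⟩
      (R + P) * (T * B)
    ≡⟨ expand R P T B ⟩
      R * T * B + T * P * B
    ≤⟨ +-monoʳ-≤ (R * T * B) (*-monoˡ-≤ B TP≤FQ) ⟩
      R * T * B + F * Q * B
    ≡⟨ cong (R * T * B +_) (reorder F Q B) ⟩
      R * T * B + Q * (F * B)
    ∎)
    where
    open ≤-Reasoning
    expand : ∀ R P T B → (R + P) * (T * B) ≡ R * T * B + T * P * B
    expand = solve-∀
    reorder : ∀ F Q B → F * Q * B ≡ Q * (F * B)
    reorder = solve-∀

  Q R : ℕ → ℕ
  Q h = (h * (h + 1)) ^ h
  R h = Q h ∸ 2 ^ h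

  2^h≤Q : ∀ a → 2 ^ suc a ≤ Q (suc a)
  2^h≤Q a = ^-monoˡ-≤ (suc a) (≤-trans (s≤s (m≤n+m 1 a)) (m≤n*m (suc a + 1) (suc a)))

  module Bays (a ω : ℕ) where

    h : ℕ
    h = suc a

    large : ℕ → Bool
    large = ω ≤ᵇ_

    noSpecialIn : ℕ → List ℕ → Bool
    noSpecialIn k π = not (any (all large) (columns h k π))

    𝟙-noSpecialIn-suc : ∀ k π →
      𝟙 (noSpecialIn (suc k) π) ≡ 𝟙 (not (all large (take h π))) * 𝟙 (noSpecialIn k (drop h π))
    𝟙-noSpecialIn-suc k π = 𝟙-not-∨ (all large (take h π)) (any (all large) (columns h k (drop h π)))

    -- That is, P(none of the k columns is special) ≤ (1 − 2 ^ h / Q h) ^ t.  A non-special column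
    -- holds at most a large labels, so D + a t of them leave D for each of the first t columns.
    noSpecial-bound : ∀ t k D xs → length xs ≡ h * k → t ≤ k → 2 * k ≤ (h + 1) * D → D + a * t ≤ count large xs →
      ∑ (perms xs) (𝟙 ∘ noSpecialIn k) * Q h ^ t ≤ (h * k) ! * R h ^ t
    noSpecial-bound zero k D xs len _ _ _ = begin
        ∑ (perms xs) (𝟙 ∘ noSpecialIn k) * 1
      ≡⟨ *-identityʳ _ ⟩
        ∑ (perms xs) (𝟙 ∘ noSpecialIn k)
      ≤⟨ count≤length (noSpecialIn k) (perms xs) ⟩
        length (perms xs)
      ≡⟨ ≡-trans (length-perms xs) (cong _! len) ⟩
        (h * k) !
      ≡⟨ sym (*-identityʳ _) ⟩
        (h * k) ! * 1
      ∎
      where open ≤-Reasoning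
    noSpecial-bound (suc t) (suc k) D xs len (s≤s t≤k) dense enough = begin
        ∑ (perms xs) (𝟙 ∘ noSpecialIn (suc k)) * (Q h * Q h ^ t)
      ≡⟨ reorder (∑ (perms xs) (𝟙 ∘ noSpecialIn (suc k))) (Q h) (Q h ^ t) ⟩
        Q h * Z
      ≤⟨ complement-bound (Q h) (R h) (2 ^ h) (falling (count large xs) h) (sym (m∸n+n≡m (2^h≤Q a))) first-column column ⟩
        R h * falling (length xs) h * B
      ≡⟨ cong (λ n → R h * falling n h * B) len′ ⟩
        R h * falling (h + h * k) h * ((h * k) ! * R h ^ t)
      ≡⟨ regroup (R h) (falling (h + h * k) h) ((h * k) !) (R h ^ t) ⟩
        falling (h + h * k) h * (h * k) ! * R h ^ suc t
      ≡⟨ cong (_* R h ^ suc t) (sym (!-split h (h * k))) ⟩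
        (h + h * k) ! * R h ^ suc t
      ≡⟨ cong (λ n → n ! * R h ^ suc t) (sym (*-suc h k)) ⟩
        (h * suc k) ! * R h ^ suc t
      ∎
      where
      open ≤-Reasoning
      reorder : ∀ c Q q → c * (Q * q) ≡ Q * (c * q)
      reorder = solve-∀
      regroup : ∀ R F f r → R * F * (f * r) ≡ F * f * (R * r)
      regroup = solve-∀
      len′ : length xs ≡ h + h * k
      len′ = ≡-trans len (*-suc h k)
      B = (h * k) ! * R h ^ t
      Z = ∑ (perms xs) (𝟙 ∘ noSpecialIn (suc k)) * Q h ^ t
      g : List ℕ → ℕ
      g π = 𝟙 (noSpecialIn k π) * Q h ^ t
      first-split : ∑ (perms xs) (λ π → 𝟙 (not (all large (take h π))) * g (drop h π)) ≡ Z
      first-split = ≡-trans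
        (∑-cong (All.universal (λ π → ≡-trans (sym (*-assoc (𝟙 (not (all large (take h π)))) _ (Q h ^ t)))
          (cong (_* Q h ^ t) (sym (𝟙-noSpecialIn-suc k π)))) (perms xs)))
        (∑-*ʳ (Q h ^ t) (perms xs) (𝟙 ∘ noSpecialIn (suc k)))
      rest-bound : ∀ r → length r + h ≡ length xs → count large xs ≤ a + count large r → ∑ (perms r) g ≤ B
      rest-bound r len-r enough-r = ≤-trans (≤-reflexive (∑-*ʳ (Q h ^ t) (perms r) (𝟙 ∘ noSpecialIn k)))
        (noSpecial-bound t k D r
          (+-cancelʳ-≡ h (length r) (h * k) (≡-trans len-r (≡-trans len′ (+-comm h (h * k)))))
          t≤k
          (≤-trans (*-monoʳ-≤ 2 (n≤1+n k)) dense)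
          (+-cancelˡ-≤ a (D + a * t) (count large r) (≤-trans (≤-reflexive (shuffle a D t)) (≤-trans enough enough-r))))
        where
        shuffle : ∀ a D t → a + (D + a * t) ≡ D + a * suc t
        shuffle = solve-∀
      first-column : Z + falling (count large xs) h * B ≤ falling (length xs) h * B
      first-column = subst (λ z → z + falling (count large xs) h * B ≤ falling (length xs) h * B) first-split
        (∑-perms-prefix-bound large a xs g B (subst (h ≤_) (sym len′) (m≤m+n h (h * k))) rest-bound)
      column : falling (length xs) h * 2 ^ h ≤ falling (count large xs) h * Q h
      column = subst (λ n → falling n h * 2 ^ h ≤ falling (count large xs) h * Q h) (sym len)
        (column-bound a (suc k) D (count large xs) dense
          (≤-trans (+-monoˡ-≤ D (m≤m*n a (suc t))) (≤-trans (≤-reflexive (+-comm (a * suc t) D)) enough)))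

  length-filterᵇ : ∀ {A : Set} (p : A → Bool) xs → length (filterᵇ p xs) ≡ count p xs
  length-filterᵇ p [] = refl
  length-filterᵇ p (x ∷ xs) with p x
  ... | true = cong suc (length-filterᵇ p xs)
  ... | false = length-filterᵇ p xs

  ≤-count-applyUpTo : ∀ (p : ℕ → Bool) f n m → (∀ i → T (p (f (n + i)))) → m ≤ count p (applyUpTo f (n + m))
  ≤-count-applyUpTo p f (suc n) m holds = ≤-trans (≤-count-applyUpTo p (f ∘ suc) n m holds) (m≤n+m _ (𝟙 (p (f 0))))
  ≤-count-applyUpTo p f zero zero holds = z≤n
  ≤-count-applyUpTo p f zero (suc m) holds with p (f 0) | holds 0
  ... | true | _ = s≤s (≤-count-applyUpTo p (f ∘ suc) zero m (holds ∘ suc))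

  bays-bound : ∀ a C t r → (suc a + 1) * t + r ≡ suc C →
    length (filterᵇ (noSpecial (suc a) C) (allBays (suc a) C)) * Q (suc a) ^ t ≤ (suc a * suc C) ! * R (suc a) ^ t
  bays-bound a C t r m≡ = subst (λ n → n * Q h ^ t ≤ (h * m) ! * R h ^ t)
    (sym (length-filterᵇ (noSpecial h C) (allBays h C)))
    (noSpecial-bound t m (2 * t + r) (labels (h * m)) length-labels t≤m dense enough)
    where
    open Bays a (omega (suc a) C)
    m = suc C
    length-labels : length (labels (h * m)) ≡ h * m
    length-labels = ≡-trans (length-map suc (upTo (h * m))) (length-upTo (h * m))
    t≤m : t ≤ m
    t≤m = ≤-trans (m≤n*m t (h + 1)) (≤-trans (m≤m+n ((h + 1) * t) r) (≤-reflexive m≡))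
    dense : 2 * m ≤ (h + 1) * (2 * t + r)
    dense = begin
        2 * m
      ≡⟨ cong (2 *_) (sym m≡) ⟩
        2 * ((h + 1) * t + r)
      ≡⟨ split₁ (h + 1) t r ⟩
        (h + 1) * (2 * t) + 2 * r
      ≤⟨ +-monoʳ-≤ ((h + 1) * (2 * t)) (*-monoˡ-≤ r (s≤s (m≤n+m 1 a))) ⟩
        (h + 1) * (2 * t) + (h + 1) * r
      ≡⟨ sym (*-distribˡ-+ (h + 1) (2 * t) r) ⟩
        (h + 1) * (2 * t + r)
      ∎
      where
      open ≤-Reasoning
      split₁ : ∀ H t r → 2 * (H * t + r) ≡ H * (2 * t) + 2 * r
      split₁ = solve-∀
    large-labels : m ≤ count large (labels (h * m))
    large-labels = subst (λ xs → m ≤ count large xs)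
      (sym (≡-trans (map-upTo suc (h * m)) (cong (applyUpTo suc) (+-comm m (a * m)))))
      (≤-count-applyUpTo large suc (a * m) m
        (λ i → ≤⇒≤ᵇ (≤-trans (≤-reflexive (+-comm (a * m) 1)) (s≤s (m≤m+n (a * m) i)))))
    enough : 2 * t + r + a * t ≤ count large (labels (h * m))
    enough = ≤-trans (≤-reflexive (≡-trans (regroup a t r) m≡)) large-labels
      where
      regroup : ∀ a t r → 2 * t + r + a * t ≡ (suc a + 1) * t + r
      regroup = solve-∀

module Rationals where

  open import Relation.Nullary.Decidable using (dec⇒maybe)
  open import Level using (0ℓ)
  open import Data.Nat as ℕ using (ℕ; zero; suc; _!)
  import Data.Nat.Properties as ℕ
  open import Data.Integer as ℤ using (+_)
  import Data.Integer.Properties as ℤ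
  open import Data.Integer.Tactic.RingSolver renaming (solve-∀ to solve-ℤ)
  open import Data.Rational
  open import Data.Rational.Properties
  import Data.Rational.Unnormalised as ℚᵘ
  import Data.Rational.Unnormalised.Properties as ℚᵘ
  open import Relation.Binary.PropositionalEquality
  open import Tactic.RingSolver using (solve-∀)
  import Tactic.RingSolver.Core.AlmostCommutativeRing as ACR

  -- The zero test on coefficients is what lets the solver normalise rational constants.
  ℚ-ring : ACR.AlmostCommutativeRing 0ℓ 0ℓ
  ℚ-ring = ACR.fromCommutativeRing +-*-commutativeRing (λ x → dec⇒maybe (0ℚ ≟ x))

  ι : ℕ → ℚ
  ι n = + n / 1

  toℚᵘ-ι : ∀ n → toℚᵘ (ι n) ℚᵘ.≃ ℚᵘ.mkℚᵘ (+ n) 0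
  toℚᵘ-ι n = toℚᵘ-fromℚᵘ (ℚᵘ.mkℚᵘ (+ n) 0)

  ι-+ : ∀ m n → ι (m ℕ.+ n) ≡ ι m + ι n
  ι-+ m n = toℚᵘ-injective (begin
      toℚᵘ (ι (m ℕ.+ n))                              ≈⟨ toℚᵘ-ι (m ℕ.+ n) ⟩
      ℚᵘ.mkℚᵘ (+ m ℤ.+ + n) 0                         ≈⟨ ℚᵘ.*≡* (eq (+ m) (+ n)) ⟩
      ℚᵘ.mkℚᵘ (+ m) 0 ℚᵘ.+ ℚᵘ.mkℚᵘ (+ n) 0            ≈⟨ ℚᵘ.+-cong (toℚᵘ-ι m) (toℚᵘ-ι n) ⟨
      toℚᵘ (ι m) ℚᵘ.+ toℚᵘ (ι n)                      ≈⟨ toℚᵘ-homo-+ (ι m) (ι n) ⟨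
      toℚᵘ (ι m + ι n)                                ∎)
    where
    open ℚᵘ.≃-Reasoning
    eq : ∀ x y → (x ℤ.+ y) ℤ.* ℤ.1ℤ ≡ (x ℤ.* ℤ.1ℤ ℤ.+ y ℤ.* ℤ.1ℤ) ℤ.* ℤ.1ℤ
    eq = solve-ℤ

  ι-* : ∀ m n → ι (m ℕ.* n) ≡ ι m * ι n
  ι-* m n = toℚᵘ-injective (begin
      toℚᵘ (ι (m ℕ.* n))                              ≈⟨ toℚᵘ-ι (m ℕ.* n) ⟩
      ℚᵘ.mkℚᵘ (+ (m ℕ.* n)) 0                         ≈⟨ ℚᵘ.*≡* (cong (ℤ._* ℤ.1ℤ) (ℤ.pos-* m n)) ⟩
      ℚᵘ.mkℚᵘ (+ m) 0 ℚᵘ.* ℚᵘ.mkℚᵘ (+ n) 0            ≈⟨ ℚᵘ.*-cong (toℚᵘ-ι m) (toℚᵘ-ι n) ⟨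
      toℚᵘ (ι m) ℚᵘ.* toℚᵘ (ι n)                      ≈⟨ toℚᵘ-homo-* (ι m) (ι n) ⟨
      toℚᵘ (ι m * ι n)                                ∎)
    where open ℚᵘ.≃-Reasoning

  frac-*-ι : ∀ n d → .{{_ : ℕ.NonZero d}} → frac n d * ι d ≡ ι n
  frac-*-ι n (suc d) = toℚᵘ-injective (begin
      toℚᵘ (frac n (suc d) * ι (suc d))               ≈⟨ toℚᵘ-homo-* (frac n (suc d)) (ι (suc d)) ⟩
      toℚᵘ (frac n (suc d)) ℚᵘ.* toℚᵘ (ι (suc d))
        ≈⟨ ℚᵘ.*-cong (toℚᵘ-fromℚᵘ (ℚᵘ.mkℚᵘ (+ n) d)) (toℚᵘ-ι (suc d)) ⟩
      ℚᵘ.mkℚᵘ (+ n) d ℚᵘ.* ℚᵘ.mkℚᵘ (+ suc d) 0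
        ≈⟨ ℚᵘ.*≡* (trans (eq (+ n) (+ suc d)) (cong (+ n ℤ.*_) (ℤ.pos-* (suc d) 1))) ⟩
      ℚᵘ.mkℚᵘ (+ n) 0                                 ≈⟨ toℚᵘ-ι n ⟨
      toℚᵘ (ι n)                                      ∎)
    where
    open ℚᵘ.≃-Reasoning
    eq : ∀ x y → (x ℤ.* y) ℤ.* ℤ.1ℤ ≡ x ℤ.* (y ℤ.* ℤ.1ℤ)
    eq = solve-ℤ

  ι-^ : ∀ m n → ι (m ℕ.^ n) ≡ ι m ^ℚ n
  ι-^ m zero = refl
  ι-^ m (suc n) = trans (ι-* m (m ℕ.^ n)) (cong (ι m *_) (ι-^ m n))

  ι-nonNeg : ∀ n → 0ℚ ≤ ι n
  ι-nonNeg n = nonNegative⁻¹ (ι n) {{normalize-nonNeg n 1}}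

  ι-pos : ∀ n → .{{_ : ℕ.NonZero n}} → 0ℚ < ι n
  ι-pos (suc n) = positive⁻¹ (ι (suc n)) {{normalize-pos (suc n) 1}}

  ι-mono-≤ : ∀ {m n} → m ℕ.≤ n → ι m ≤ ι n
  ι-mono-≤ {m} {n} m≤n = begin
      ι m                    ≡⟨ +-identityʳ (ι m) ⟨
      ι m + 0ℚ               ≤⟨ +-monoʳ-≤ (ι m) (ι-nonNeg (n ℕ.∸ m)) ⟩
      ι m + ι (n ℕ.∸ m)      ≡⟨ ι-+ m (n ℕ.∸ m) ⟨
      ι (m ℕ.+ (n ℕ.∸ m))    ≡⟨ cong ι (ℕ.m+[n∸m]≡n m≤n) ⟩
      ι n                    ∎
    where open ≤-Reasoning

  frac-nonNeg : ∀ n d → 0ℚ ≤ frac n d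
  frac-nonNeg n zero = ≤-refl
  frac-nonNeg n (suc d) = nonNegative⁻¹ (frac n (suc d)) {{normalize-nonNeg n (suc d)}}

  *-nonNeg : ∀ {p q} → 0ℚ ≤ p → 0ℚ ≤ q → 0ℚ ≤ p * q
  *-nonNeg {p} {q} 0≤p 0≤q = nonNegative⁻¹ (p * q) {{nonNeg*nonNeg⇒nonNeg p {{nonNegative 0≤p}} q {{nonNegative 0≤q}}}}

  *-monoˡ-≤ : ∀ {r p q} → 0ℚ ≤ r → p ≤ q → r * p ≤ r * q
  *-monoˡ-≤ {r} 0≤r = *-monoˡ-≤-nonNeg r {{nonNegative 0≤r}}

  *-monoʳ-≤ : ∀ {r p q} → 0ℚ ≤ r → p ≤ q → p * r ≤ q * r
  *-monoʳ-≤ {r} 0≤r = *-monoʳ-≤-nonNeg r {{nonNegative 0≤r}}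

  *-cancelʳ-≤ : ∀ {r p q} → 0ℚ < r → p * r ≤ q * r → p ≤ q
  *-cancelʳ-≤ {r} 0<r = *-cancelʳ-≤-pos r {{positive 0<r}}

  ^ℚ-nonNeg : ∀ {x} n → 0ℚ ≤ x → 0ℚ ≤ x ^ℚ n
  ^ℚ-nonNeg zero 0≤x = nonNegative⁻¹ 1ℚ
  ^ℚ-nonNeg (suc n) 0≤x = *-nonNeg 0≤x (^ℚ-nonNeg n 0≤x)

  ^ℚ-monoˡ-≤ : ∀ {x y} n → 0ℚ ≤ x → x ≤ y → x ^ℚ n ≤ y ^ℚ n
  ^ℚ-monoˡ-≤ zero 0≤x x≤y = ≤-refl
  ^ℚ-monoˡ-≤ (suc n) 0≤x x≤y =
    ≤-trans (*-monoʳ-≤ (^ℚ-nonNeg n 0≤x) x≤y) (*-monoˡ-≤ (≤-trans 0≤x x≤y) (^ℚ-monoˡ-≤ n 0≤x x≤y))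

  ^ℚ-+ : ∀ x m n → x ^ℚ (m ℕ.+ n) ≡ x ^ℚ m * x ^ℚ n
  ^ℚ-+ x zero n = sym (*-identityˡ _)
  ^ℚ-+ x (suc m) n = trans (cong (x *_) (^ℚ-+ x m n)) (sym (*-assoc x _ _))

  ^ℚ-* : ∀ x m n → x ^ℚ (m ℕ.* n) ≡ (x ^ℚ m) ^ℚ n
  ^ℚ-* x m zero = cong (x ^ℚ_) (ℕ.*-zeroʳ m)
  ^ℚ-* x m (suc n) = trans (cong (x ^ℚ_) (ℕ.*-suc m n)) (trans (^ℚ-+ x m (m ℕ.* n)) (cong (x ^ℚ m *_) (^ℚ-* x m n)))

  ^ℚ-distribʳ-* : ∀ x y n → (x * y) ^ℚ n ≡ x ^ℚ n * y ^ℚ n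
  ^ℚ-distribʳ-* x y zero = refl
  ^ℚ-distribʳ-* x y (suc n) = trans (cong (x * y *_) (^ℚ-distribʳ-* x y n)) (interchange x y (x ^ℚ n) (y ^ℚ n))
    where
    interchange : ∀ a b c d → a * b * (c * d) ≡ a * c * (b * d)
    interchange = solve-∀ ℚ-ring

  ^ℚ≤1 : ∀ {x} n → 0ℚ ≤ x → x ≤ 1ℚ → x ^ℚ n ≤ 1ℚ
  ^ℚ≤1 zero 0≤x x≤1 = ≤-refl
  ^ℚ≤1 {x} (suc n) 0≤x x≤1 = ≤-trans (*-monoˡ-≤ 0≤x (^ℚ≤1 n 0≤x x≤1)) (≤-trans (≤-reflexive (*-identityʳ x)) x≤1)

  ^ℚ-antimonoʳ-≤ : ∀ {x m n} → 0ℚ ≤ x → x ≤ 1ℚ → m ℕ.≤ n → x ^ℚ n ≤ x ^ℚ m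
  ^ℚ-antimonoʳ-≤ {x} {m} {n} 0≤x x≤1 m≤n = begin
      x ^ℚ n                          ≡⟨ cong (x ^ℚ_) (ℕ.m+[n∸m]≡n m≤n) ⟨
      x ^ℚ (m ℕ.+ (n ℕ.∸ m))          ≡⟨ ^ℚ-+ x m (n ℕ.∸ m) ⟩
      x ^ℚ m * x ^ℚ (n ℕ.∸ m)         ≤⟨ *-monoˡ-≤ (^ℚ-nonNeg m 0≤x) (^ℚ≤1 (n ℕ.∸ m) 0≤x x≤1) ⟩
      x ^ℚ m * 1ℚ                     ≡⟨ *-identityʳ _ ⟩
      x ^ℚ m                          ∎
    where open ≤-Reasoning

  p≤1⇒0≤1-p : ∀ {θ} → θ ≤ 1ℚ → 0ℚ ≤ 1ℚ - θ
  p≤1⇒0≤1-p {θ} θ≤1 = subst (_≤ 1ℚ - θ) (+-inverseʳ θ) (+-monoˡ-≤ (- θ) θ≤1)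

  p-q≤p : ∀ {p q} → 0ℚ ≤ q → p - q ≤ p
  p-q≤p {p} {q} 0≤q = subst (p - q ≤_) (+-identityʳ p) (+-monoʳ-≤ p (neg-antimono-≤ 0≤q))

  bernoulli : ∀ {θ} n → 0ℚ ≤ θ → θ ≤ 1ℚ → 1ℚ - ι n * θ ≤ (1ℚ - θ) ^ℚ n
  bernoulli {θ} zero 0≤θ θ≤1 = ≤-reflexive (cong (λ x → 1ℚ - x) (*-zeroˡ θ))
  bernoulli {θ} (suc n) 0≤θ θ≤1 = begin
      1ℚ - ι (suc n) * θ                           ≡⟨ cong (λ x → 1ℚ - x * θ) (ι-+ 1 n) ⟩
      1ℚ - (1ℚ + ι n) * θ                          ≡⟨ expand (ι n) θ ⟩
      (1ℚ - θ) * (1ℚ - ι n * θ) - ι n * (θ * θ)    ≤⟨ p-q≤p (*-nonNeg (ι-nonNeg n) (*-nonNeg 0≤θ 0≤θ)) ⟩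
      (1ℚ - θ) * (1ℚ - ι n * θ)                    ≤⟨ *-monoˡ-≤ (p≤1⇒0≤1-p θ≤1) (bernoulli n 0≤θ θ≤1) ⟩
      (1ℚ - θ) * (1ℚ - θ) ^ℚ n                     ∎
    where
    open ≤-Reasoning
    expand : ∀ n θ → 1ℚ - (1ℚ + n) * θ ≡ (1ℚ - θ) * (1ℚ - n * θ) - n * (θ * θ)
    expand = solve-∀ ℚ-ring

  ι-suc-*-frac : ∀ N → ι (suc N) * frac 1 (suc N !) ≡ frac 1 (N !)
  ι-suc-*-frac N = *-cancelʳ-≡ (ι-pos (N !) {{N ℕ.!≢0}}) (begin
      ι (suc N) * frac 1 (suc N !) * ι (N !)       ≡⟨ reorder (ι (suc N)) (frac 1 (suc N !)) (ι (N !)) ⟩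
      frac 1 (suc N !) * (ι (suc N) * ι (N !))     ≡⟨ cong (frac 1 (suc N !) *_) (ι-* (suc N) (N !)) ⟨
      frac 1 (suc N !) * ι (suc N !)               ≡⟨ frac-*-ι 1 (suc N !) {{suc N ℕ.!≢0}} ⟩
      1ℚ                                           ≡⟨ frac-*-ι 1 (N !) {{N ℕ.!≢0}} ⟨
      frac 1 (N !) * ι (N !)                       ∎)
    where
    open ≡-Reasoning
    reorder : ∀ a b c → a * b * c ≡ b * (a * c)
    reorder = solve-∀ ℚ-ring
    *-cancelʳ-≡ : ∀ {r p q} → 0ℚ < r → p * r ≡ q * r → p ≡ q
    *-cancelʳ-≡ 0<r eq = ≤-antisym (*-cancelʳ-≤ 0<r (≤-reflexive eq)) (*-cancelʳ-≤ 0<r (≤-reflexive (sym eq)))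

  ^ℚ-increment : ∀ {x θ} j → 0ℚ ≤ x → 0ℚ ≤ θ → (x + θ) ^ℚ suc j ≤ x ^ℚ suc j + ι (suc j) * θ * (x + θ) ^ℚ j
  ^ℚ-increment {x} {θ} zero 0≤x 0≤θ = ≤-reflexive (expand x θ)
    where
    expand : ∀ x θ → (x + θ) * 1ℚ ≡ x * 1ℚ + 1ℚ * θ * 1ℚ
    expand = solve-∀ ℚ-ring
  ^ℚ-increment {x} {θ} (suc j) 0≤x 0≤θ = begin
      z * z ^ℚ suc j
    ≤⟨ *-monoˡ-≤ 0≤z (^ℚ-increment j 0≤x 0≤θ) ⟩
      z * (x ^ℚ suc j + ι (suc j) * θ * z ^ℚ j)
    ≡⟨ expand x θ (x ^ℚ suc j) (ι (suc j)) (z ^ℚ j) ⟩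
      x ^ℚ suc (suc j) + θ * x ^ℚ suc j + ι (suc j) * θ * z ^ℚ suc j
    ≤⟨ +-monoˡ-≤ (ι (suc j) * θ * z ^ℚ suc j) (+-monoʳ-≤ (x ^ℚ suc (suc j)) (*-monoˡ-≤ 0≤θ x^≤z^)) ⟩
      x ^ℚ suc (suc j) + θ * z ^ℚ suc j + ι (suc j) * θ * z ^ℚ suc j
    ≡⟨ collect (x ^ℚ suc (suc j)) θ (z ^ℚ suc j) (ι (suc j)) ⟩
      x ^ℚ suc (suc j) + (1ℚ + ι (suc j)) * θ * z ^ℚ suc j
    ≡⟨ cong (λ c → x ^ℚ suc (suc j) + c * θ * z ^ℚ suc j) (ι-+ 1 (suc j)) ⟨
      x ^ℚ suc (suc j) + ι (suc (suc j)) * θ * z ^ℚ suc j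
    ∎
    where
    open ≤-Reasoning
    z = x + θ
    0≤z : 0ℚ ≤ z
    0≤z = +-mono-≤ 0≤x 0≤θ
    x^≤z^ : x ^ℚ suc j ≤ z ^ℚ suc j
    x^≤z^ = ^ℚ-monoˡ-≤ (suc j) 0≤x (subst (_≤ z) (+-identityʳ x) (+-monoʳ-≤ x 0≤θ))
    expand : ∀ x θ p c q → (x + θ) * (p + c * θ * q) ≡ x * p + θ * p + c * θ * ((x + θ) * q)
    expand = solve-∀ ℚ-ring
    collect : ∀ a θ w c → a + θ * w + c * θ * w ≡ a + (1ℚ + c) * θ * w
    collect = solve-∀ ℚ-ring

  expPartial-nonNeg : ∀ {y} N → 0ℚ ≤ y → 0ℚ ≤ expPartial y N
  expPartial-nonNeg zero 0≤y = nonNegative⁻¹ 1ℚ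
  expPartial-nonNeg (suc N) 0≤y =
    +-mono-≤ (expPartial-nonNeg N 0≤y) (*-nonNeg (^ℚ-nonNeg (suc N) 0≤y) (frac-nonNeg 1 (suc N !)))

  expPartial-mono : ∀ {y} N → 0ℚ ≤ y → expPartial y N ≤ expPartial y (suc N)
  expPartial-mono {y} N 0≤y = subst (_≤ expPartial y (suc N)) (+-identityʳ _)
    (+-monoʳ-≤ (expPartial y N) (*-nonNeg (^ℚ-nonNeg (suc N) 0≤y) (frac-nonNeg 1 (suc N !))))

  expPartial-0 : ∀ N → expPartial 0ℚ N ≡ 1ℚ
  expPartial-0 zero = refl
  expPartial-0 (suc N) = trans
    (cong₂ _+_ (expPartial-0 N) (trans (cong (_* frac 1 (suc N !)) (*-zeroˡ (0ℚ ^ℚ N))) (*-zeroˡ (frac 1 (suc N !)))))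
    (+-identityʳ 1ℚ)

  expPartial-shift-step : ∀ {x θ} N → 0ℚ ≤ x → 0ℚ ≤ θ →
    expPartial (x + θ) (suc N) ≤ expPartial x (suc N) + θ * expPartial (x + θ) N
  expPartial-shift-step {x} {θ} zero 0≤x 0≤θ = ≤-reflexive (expand x θ)
    where
    expand : ∀ x θ → 1ℚ + (x + θ) * 1ℚ * 1ℚ ≡ 1ℚ + x * 1ℚ * 1ℚ + θ * 1ℚ
    expand = solve-∀ ℚ-ring
  expPartial-shift-step {x} {θ} (suc N) 0≤x 0≤θ = begin
      E z (suc N) + z ^ℚ suc (suc N) * f (suc (suc N))
    ≤⟨ +-mono-≤ (expPartial-shift-step N 0≤x 0≤θ) (*-monoʳ-≤ (frac-nonNeg 1 (suc (suc N) !)) (^ℚ-increment (suc N) 0≤x 0≤θ)) ⟩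
      E x (suc N) + θ * E z N + (x ^ℚ suc (suc N) + ι (suc (suc N)) * θ * z ^ℚ suc N) * f (suc (suc N))
    ≡⟨ regroup (E x (suc N)) θ (E z N) (x ^ℚ suc (suc N)) (ι (suc (suc N))) (z ^ℚ suc N) (f (suc (suc N))) ⟩
      E x (suc N) + x ^ℚ suc (suc N) * f (suc (suc N)) + θ * (E z N + z ^ℚ suc N * (ι (suc (suc N)) * f (suc (suc N))))
    ≡⟨ cong (λ c → E x (suc (suc N)) + θ * (E z N + z ^ℚ suc N * c)) (ι-suc-*-frac (suc N)) ⟩
      E x (suc (suc N)) + θ * E z (suc N)
    ∎
    where
    open ≤-Reasoning
    E = expPartial
    z = x + θ
    f : ℕ → ℚ
    f k = frac 1 (k !)
    regroup : ∀ A θ B p c q g → A + θ * B + (p + c * θ * q) * g ≡ A + p * g + θ * (B + q * (c * g))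
    regroup = solve-∀ ℚ-ring

  expPartial-shift : ∀ {x θ} N → 0ℚ ≤ x → 0ℚ ≤ θ → θ ≤ 1ℚ → (1ℚ - θ) * expPartial (x + θ) N ≤ expPartial x N
  expPartial-shift {x} {θ} zero 0≤x 0≤θ θ≤1 = subst (_≤ 1ℚ) (sym (*-identityʳ (1ℚ - θ))) (p-q≤p 0≤θ)
  expPartial-shift {x} {θ} (suc N) 0≤x 0≤θ θ≤1 = begin
      (1ℚ - θ) * E z (suc N)
    ≡⟨ expand θ (E z (suc N)) ⟩
      E z (suc N) - θ * E z (suc N)
    ≤⟨ +-monoˡ-≤ (- (θ * E z (suc N))) (expPartial-shift-step N 0≤x 0≤θ) ⟩
      E x (suc N) + θ * E z N - θ * E z (suc N)
    ≤⟨ +-monoˡ-≤ (- (θ * E z (suc N))) (+-monoʳ-≤ (E x (suc N)) (*-monoˡ-≤ 0≤θ (expPartial-mono N 0≤z))) ⟩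
      E x (suc N) + θ * E z (suc N) - θ * E z (suc N)
    ≡⟨ cancel (E x (suc N)) (θ * E z (suc N)) ⟩
      E x (suc N)
    ∎
    where
    open ≤-Reasoning
    E = expPartial
    z = x + θ
    0≤z : 0ℚ ≤ z
    0≤z = +-mono-≤ 0≤x 0≤θ
    expand : ∀ θ A → (1ℚ - θ) * A ≡ A - θ * A
    expand = solve-∀ ℚ-ring
    cancel : ∀ a b → a + b - b ≡ a
    cancel = solve-∀ ℚ-ring

  ^ℚ-*-expPartial≤1 : ∀ {θ} m N → 0ℚ ≤ θ → θ ≤ 1ℚ → (1ℚ - θ) ^ℚ m * expPartial (θ * ι m) N ≤ 1ℚ
  ^ℚ-*-expPartial≤1 {θ} zero N 0≤θ θ≤1 =
    ≤-reflexive (trans (*-identityˡ _) (trans (cong (λ y → expPartial y N) (*-zeroʳ θ)) (expPartial-0 N)))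
  ^ℚ-*-expPartial≤1 {θ} (suc m) N 0≤θ θ≤1 = begin
      (1ℚ - θ) * (1ℚ - θ) ^ℚ m * expPartial (θ * ι (suc m)) N
    ≡⟨ cong (λ y → (1ℚ - θ) * (1ℚ - θ) ^ℚ m * expPartial y N) (trans (cong (θ *_) (ι-+ 1 m)) (distrib θ (ι m))) ⟩
      (1ℚ - θ) * (1ℚ - θ) ^ℚ m * expPartial (θ * ι m + θ) N
    ≡⟨ reorder (1ℚ - θ) ((1ℚ - θ) ^ℚ m) (expPartial (θ * ι m + θ) N) ⟩
      (1ℚ - θ) ^ℚ m * ((1ℚ - θ) * expPartial (θ * ι m + θ) N)
    ≤⟨ *-monoˡ-≤ (^ℚ-nonNeg m (p≤1⇒0≤1-p θ≤1)) (expPartial-shift N (*-nonNeg 0≤θ (ι-nonNeg m)) 0≤θ θ≤1) ⟩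
      (1ℚ - θ) ^ℚ m * expPartial (θ * ι m) N
    ≤⟨ ^ℚ-*-expPartial≤1 m N 0≤θ θ≤1 ⟩
      1ℚ
    ∎
    where
    open ≤-Reasoning
    distrib : ∀ θ a → θ * (1ℚ + a) ≡ θ * a + θ
    distrib = solve-∀ ℚ-ring
    reorder : ∀ a b c → a * b * c ≡ b * (a * c)
    reorder = solve-∀ ℚ-ring

open import Data.Nat using (ℕ; suc; _≤_)
open import Data.Integer using (+_)
open import Data.Rational using (ℚ; _/_; _*_) renaming (_≤_ to _≤ℚ_)
open import Data.Rational using (1ℚ)

import Data.Nat as ℕ
import Data.Nat.Properties as ℕ
import Data.Nat.DivMod as ℕ-DivMod
import Data.Nat.Tactic.RingSolver as ℕ-Solver
open import Tactic.RingSolver using (solve-∀)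
open import Data.Rational using (0ℚ; _-_)
open import Data.Rational.Properties
  using (≤-trans; ≤-reflexive; +-monoʳ-≤; neg-antimono-≤; *-identityˡ; *-identityʳ; *-comm; *-assoc; module ≤-Reasoning)
open import Relation.Binary.PropositionalEquality using (_≡_; sym; trans; cong; cong₂; subst; module ≡-Reasoning)
open import Data.Product using (Σ; _×_; _,_)
open import Data.List using (length; filterᵇ)
open Counting using (Q; R; 2^h≤Q; bays-bound)
open Rationals

ρ : ℕ → ℚ
ρ h = frac 2 (h ℕ.* (h ℕ.+ 1)) ^ℚ h

module _ (a : ℕ) where

  private
    h H : ℕ
    h = suc a
    H = h ℕ.* (h ℕ.+ 1)

  ρ-*-Q : ρ h * ι (Q h) ≡ ι (2 ℕ.^ h)
  ρ-*-Q = begin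
      frac 2 H ^ℚ h * ι (H ℕ.^ h)       ≡⟨ cong (frac 2 H ^ℚ h *_) (ι-^ H h) ⟩
      frac 2 H ^ℚ h * ι H ^ℚ h          ≡⟨ ^ℚ-distribʳ-* (frac 2 H) (ι H) h ⟨
      (frac 2 H * ι H) ^ℚ h             ≡⟨ cong (_^ℚ h) (frac-*-ι 2 H) ⟩
      ι 2 ^ℚ h                          ≡⟨ ι-^ 2 h ⟨
      ι (2 ℕ.^ h)                       ∎
    where open ≡-Reasoning

  1-ρ-*-Q : (1ℚ - ρ h) * ι (Q h) ≡ ι (R h)
  1-ρ-*-Q = begin
      (1ℚ - ρ h) * ι (Q h)                          ≡⟨ expand (ρ h) (ι (Q h)) ⟩
      ι (Q h) - ρ h * ι (Q h)                       ≡⟨ cong₂ _-_ (cong ι (ℕ.m∸n+n≡m (2^h≤Q a))) (sym ρ-*-Q) ⟨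
      ι (R h ℕ.+ 2 ℕ.^ h) - ι (2 ℕ.^ h)             ≡⟨ cong (_- ι (2 ℕ.^ h)) (ι-+ (R h) (2 ℕ.^ h)) ⟩
      ι (R h) + ι (2 ℕ.^ h) - ι (2 ℕ.^ h)           ≡⟨ cancel (ι (R h)) (ι (2 ℕ.^ h)) ⟩
      ι (R h)                                       ∎
    where
    open ≡-Reasoning
    open Data.Rational using (_+_)
    expand : ∀ r q → (1ℚ - r) * q ≡ q - r * q
    expand = solve-∀ ℚ-ring
    cancel : ∀ x y → x + y - y ≡ x
    cancel = solve-∀ ℚ-ring

  ρ-nonNeg : 0ℚ ≤ℚ ρ h
  ρ-nonNeg = ^ℚ-nonNeg h (frac-nonNeg 2 H)

  ρ≤1 : ρ h ≤ℚ 1ℚ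
  ρ≤1 = *-cancelʳ-≤ (ι-pos (Q h) {{ℕ.m^n≢0 H h}}) (begin
      ρ h * ι (Q h)       ≡⟨ ρ-*-Q ⟩
      ι (2 ℕ.^ h)         ≤⟨ ι-mono-≤ (2^h≤Q a) ⟩
      ι (Q h)             ≡⟨ *-identityˡ (ι (Q h)) ⟨
      1ℚ * ι (Q h)        ∎)
    where open ≤-Reasoning

  private
    c : ℚ
    c = frac 1 (8 ℕ.* h)

    θ≡c*ρ*ρ : theta h ≡ c * ρ h * ρ h
    θ≡c*ρ*ρ = trans (cong (c *_) (trans (cong (frac 2 H ^ℚ_) (cong (h ℕ.+_) (ℕ.+-identityʳ h))) (^ℚ-+ (frac 2 H) h h)))
      (sym (*-assoc c (ρ h) (ρ h)))

    ι-*-c≤1 : ∀ {k} → k ℕ.≤ 8 ℕ.* h → ι k * c ≤ℚ 1ℚ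
    ι-*-c≤1 k≤8h = ≤-trans (*-monoʳ-≤ (frac-nonNeg 1 (8 ℕ.* h)) (ι-mono-≤ k≤8h))
      (≤-reflexive (trans (*-comm (ι (8 ℕ.* h)) c) (frac-*-ι 1 (8 ℕ.* h))))

    ρ*ρ≤ρ : ρ h * ρ h ≤ℚ ρ h
    ρ*ρ≤ρ = ≤-trans (*-monoˡ-≤ ρ-nonNeg ρ≤1) (≤-reflexive (*-identityʳ (ρ h)))

  θ-nonNeg : 0ℚ ≤ℚ theta h
  θ-nonNeg = subst (0ℚ ≤ℚ_) (sym θ≡c*ρ*ρ) (*-nonNeg (*-nonNeg (frac-nonNeg 1 (8 ℕ.* h)) ρ-nonNeg) ρ-nonNeg)

  θ≤1 : theta h ≤ℚ 1ℚ
  θ≤1 = begin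
      theta h             ≡⟨ trans θ≡c*ρ*ρ (cong (λ x → x * ρ h * ρ h) (sym (*-identityˡ c))) ⟩
      ι 1 * c * ρ h * ρ h ≤⟨ *-monoʳ-≤ ρ-nonNeg (*-monoʳ-≤ ρ-nonNeg (ι-*-c≤1 (ℕ.s≤s ℕ.z≤n))) ⟩
      1ℚ * ρ h * ρ h      ≡⟨ cong (_* ρ h) (*-identityˡ (ρ h)) ⟩
      ρ h * ρ h           ≤⟨ ρ*ρ≤ρ ⟩
      ρ h                 ≤⟨ ρ≤1 ⟩
      1ℚ                  ∎
    where open ≤-Reasoning

  1-ρ≤[1-θ]^ : 1ℚ - ρ h ≤ℚ (1ℚ - theta h) ^ℚ (2 ℕ.* (h ℕ.+ 1))
  1-ρ≤[1-θ]^ = ≤-trans (+-monoʳ-≤ 1ℚ (neg-antimono-≤ Kθ≤ρ)) (bernoulli (2 ℕ.* (h ℕ.+ 1)) θ-nonNeg θ≤1)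
    where
    K≤8h : 2 ℕ.* (h ℕ.+ 1) ℕ.≤ 8 ℕ.* h
    K≤8h = subst (2 ℕ.* (h ℕ.+ 1) ℕ.≤_) (split a) (ℕ.m≤m+n (2 ℕ.* (h ℕ.+ 1)) (6 ℕ.* a ℕ.+ 4))
      where
      split : ∀ a → 2 ℕ.* (suc a ℕ.+ 1) ℕ.+ (6 ℕ.* a ℕ.+ 4) ≡ 8 ℕ.* suc a
      split = ℕ-Solver.solve-∀
    Kθ≤ρ : ι (2 ℕ.* (h ℕ.+ 1)) * theta h ≤ℚ ρ h
    Kθ≤ρ = begin
        ι K * theta h           ≡⟨ trans (cong (ι K *_) θ≡c*ρ*ρ) (reassoc (ι K) c (ρ h)) ⟩
        ι K * c * (ρ h * ρ h)   ≤⟨ *-monoʳ-≤ (*-nonNeg ρ-nonNeg ρ-nonNeg) (ι-*-c≤1 K≤8h) ⟩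
        1ℚ * (ρ h * ρ h)        ≡⟨ *-identityˡ _ ⟩
        ρ h * ρ h               ≤⟨ ρ*ρ≤ρ ⟩
        ρ h                     ∎
      where
      open ≤-Reasoning
      K = 2 ℕ.* (h ℕ.+ 1)
      reassoc : ∀ k c r → k * (c * r * r) ≡ k * c * (r * r)
      reassoc = solve-∀ ℚ-ring

  probNotOmega≤[1-ρ]^ : ∀ C t r → (h ℕ.+ 1) ℕ.* t ℕ.+ r ≡ suc C → probNotOmega h C ≤ℚ (1ℚ - ρ h) ^ℚ t
  probNotOmega≤[1-ρ]^ C t r m≡ = *-cancelʳ-≤ (ι-pos (F ℕ.* Q h ℕ.^ t)) (begin
      frac n F * ι (F ℕ.* Q h ℕ.^ t)             ≡⟨ cong (frac n F *_) (ι-* F (Q h ℕ.^ t)) ⟩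
      frac n F * (ι F * ι (Q h ℕ.^ t))           ≡⟨ *-assoc (frac n F) (ι F) _ ⟨
      frac n F * ι F * ι (Q h ℕ.^ t)             ≡⟨ cong (_* ι (Q h ℕ.^ t)) (frac-*-ι n F) ⟩
      ι n * ι (Q h ℕ.^ t)                        ≡⟨ ι-* n (Q h ℕ.^ t) ⟨
      ι (n ℕ.* Q h ℕ.^ t)                        ≤⟨ ι-mono-≤ (bays-bound a C t r m≡) ⟩
      ι (F ℕ.* R h ℕ.^ t)                        ≡⟨ trans (ι-* F (R h ℕ.^ t)) (cong (ι F *_) (ι-^ (R h) t)) ⟩
      ι F * ι (R h) ^ℚ t                         ≡⟨ cong (λ x → ι F * x ^ℚ t) 1-ρ-*-Q ⟨
      ι F * ((1ℚ - ρ h) * ι (Q h)) ^ℚ t          ≡⟨ cong (ι F *_) (^ℚ-distribʳ-* (1ℚ - ρ h) (ι (Q h)) t) ⟩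
      ι F * ((1ℚ - ρ h) ^ℚ t * ι (Q h) ^ℚ t)     ≡⟨ reorder (ι F) ((1ℚ - ρ h) ^ℚ t) (ι (Q h) ^ℚ t) ⟩
      (1ℚ - ρ h) ^ℚ t * (ι F * ι (Q h) ^ℚ t)     ≡⟨ cong (λ x → (1ℚ - ρ h) ^ℚ t * (ι F * x)) (ι-^ (Q h) t) ⟨
      (1ℚ - ρ h) ^ℚ t * (ι F * ι (Q h ℕ.^ t))    ≡⟨ cong ((1ℚ - ρ h) ^ℚ t *_) (ι-* F (Q h ℕ.^ t)) ⟨
      (1ℚ - ρ h) ^ℚ t * ι (F ℕ.* Q h ℕ.^ t)      ∎)
    where
    open ≤-Reasoning
    F = (h ℕ.* suc C) ℕ.!
    instance
      F≢0 : ℕ.NonZero F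
      F≢0 = ℕ._!≢0 (h ℕ.* suc C)
      Q^t≢0 : ℕ.NonZero (Q h ℕ.^ t)
      Q^t≢0 = ℕ.m^n≢0 (Q h) t {{ℕ.m^n≢0 H h}}
      FQ^t≢0 : ℕ.NonZero (F ℕ.* Q h ℕ.^ t)
      FQ^t≢0 = ℕ.m*n≢0 F (Q h ℕ.^ t)
    n = length (filterᵇ (noSpecial h C) (allBays h C))
    reorder : ∀ x y z → x * (y * z) ≡ y * (x * z)
    reorder = solve-∀ ℚ-ring

coarse-division : ∀ d m .{{_ : ℕ.NonZero d}} → d ≤ m →
  Σ ℕ λ t → Σ ℕ λ r → d ℕ.* t ℕ.+ r ≡ m × m ≤ 2 ℕ.* d ℕ.* t
coarse-division d m d≤m = t , r , m≡ , m≤2dt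
  where
  open ℕ-DivMod using (_%_; m≡m%n+[m/n]*n; m%n<n; m≥n⇒m/n>0)
  t = m ℕ-DivMod./ d
  r = m % d
  m≡ : d ℕ.* t ℕ.+ r ≡ m
  m≡ = trans (ℕ.+-comm (d ℕ.* t) r) (trans (cong (r ℕ.+_) (ℕ.*-comm d t)) (sym (m≡m%n+[m/n]*n m d)))
  m≤2dt : m ≤ 2 ℕ.* d ℕ.* t
  m≤2dt = begin
      m                      ≡⟨ m≡ ⟨
      d ℕ.* t ℕ.+ r          ≤⟨ ℕ.+-monoʳ-≤ (d ℕ.* t) (ℕ.<⇒≤ (m%n<n m d)) ⟩
      d ℕ.* t ℕ.+ d          ≤⟨ ℕ.+-monoʳ-≤ (d ℕ.* t) (ℕ.m≤m*n d t {{ℕ.>-nonZero (m≥n⇒m/n>0 d≤m)}}) ⟩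
      d ℕ.* t ℕ.+ d ℕ.* t    ≡⟨ double d t ⟩
      2 ℕ.* d ℕ.* t          ∎
    where
    open ℕ.≤-Reasoning
    double : ∀ d t → d ℕ.* t ℕ.+ d ℕ.* t ≡ 2 ℕ.* d ℕ.* t
    double = ℕ-Solver.solve-∀

lemma2 : (h C : ℕ) → 1 ≤ h → h ≤ C →
    (N : ℕ) → probNotOmega h C * expPartial (theta h * ((+ suc C) / 1)) N ≤ℚ 1ℚ
lemma2 (suc a) C _ h≤C N with coarse-division (suc a ℕ.+ 1) (suc C) (subst (_≤ suc C) (ℕ.+-comm 1 (suc a)) (ℕ.s≤s h≤C))
... | t , r , m≡ , m≤Kt = begin
    probNotOmega h C * expPartial (θ * ι m) N
  ≤⟨ *-monoʳ-≤ (expPartial-nonNeg N (*-nonNeg (θ-nonNeg a) (ι-nonNeg m))) probNotOmega≤[1-θ]^m ⟩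
    (1ℚ - θ) ^ℚ m * expPartial (θ * ι m) N
  ≤⟨ ^ℚ-*-expPartial≤1 m N (θ-nonNeg a) (θ≤1 a) ⟩
    1ℚ
  ∎
  where
  open ≤-Reasoning
  h = suc a
  m = suc C
  θ = theta h
  probNotOmega≤[1-θ]^m : probNotOmega h C ≤ℚ (1ℚ - θ) ^ℚ m
  probNotOmega≤[1-θ]^m = begin
      probNotOmega h C                     ≤⟨ probNotOmega≤[1-ρ]^ a C t r m≡ ⟩
      (1ℚ - ρ h) ^ℚ t                      ≤⟨ ^ℚ-monoˡ-≤ t (p≤1⇒0≤1-p (ρ≤1 a)) (1-ρ≤[1-θ]^ a) ⟩
      ((1ℚ - θ) ^ℚ (2 ℕ.* (h ℕ.+ 1))) ^ℚ t  ≡⟨ ^ℚ-* (1ℚ - θ) (2 ℕ.* (h ℕ.+ 1)) t ⟨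
      (1ℚ - θ) ^ℚ (2 ℕ.* (h ℕ.+ 1) ℕ.* t)   ≤⟨ ^ℚ-antimonoʳ-≤ (p≤1⇒0≤1-p (θ≤1 a)) (p-q≤p (θ-nonNeg a)) m≤Kt ⟩
      (1ℚ - θ) ^ℚ m                        ∎
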